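{- Let $(X,R,D)$ be a point-generated frame validating $\mathrm{KB}^{\neq}$, and let $M=(X,R,D,\theta)$ be a model on it in which every substitution instance of $\mathrm{Con}$ is true at every point. Let $\Gamma$ be a finite subformula-closed set of bimodal formulas. Then for every finite set of formulas $\Psi\supseteq\Gamma$ and every $\Gamma$-filtration $\widehat{M}=(X/{\sim_\Psi},\widehat{R},\widehat{D},\widehat{\theta})$ of $M$, the frame $(X/{\sim_\Psi},\widehat{R})$ is connected.
   Context: Bimodal formulas use $\lozenge$ (interpreted by $R$) and $\langle\neq\rangle$ (interpreted by $D$); $\exists\varphi:=\langle\neq\rangle\varphi\vee\varphi$. $\mathrm{Con}$ is the formula $\exists p\wedge\exists\neg p\to\exists(p\wedge\lozenge\neg p)$. $\mathrm{KB}$ is the smallest normal unimodal logic containing $p\to\Box\lozenge p$; $L^{\neq}$ is the smallest normal bimodal logic containing $L$ and $p\to[\neq]\langle\neq\rangle p$, $\langle\neq\rangle\langle\neq\rangle p\to\exists p$, $\lozenge p\to\exists p$. A frame is point-generated if it is the smallest set containing some point and closed under successors along both relations. For a set of formulas $\Psi$, $x\sim_\Psi y$ iff $x,y$ satisfy the same formulas of $\Psi$ in $M$. A $\Gamma$-filtration of $M=(X,R_0,R_1,\theta)$ is a model $(X/{\sim},\widehat{R}_0,\widehat{R}_1,\widehat{\theta})$ with $\sim\subseteq\sim_\Gamma$ an equivalence, $[x]\in\widehat\theta(p)$ iff $x\in\theta(p)$ for variables $p\in\Gamma$, and $(R_i)_\sim\subseteq\widehat R_i\subseteq(R_i)^\Gamma_\sim$,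 where $[x](R_i)_\sim[y]$ iff $x'R_iy'$ for some $x'\sim x$, $y'\sim y$, and $[x](R_i)^\Gamma_\sim[y]$ iff for all $\lozenge_i\psi\in\Gamma$, $M,y\models\psi$ implies $M,x\models\lozenge_i\psi$. $(Y,S)$ is connected if any two points are joined by a finite sequence $y_0,\dots,y_n$ with $y_iSy_{i+1}$ or $y_{i+1}Sy_i$ for each $i$. -}

module Defs where

open import Data.Nat using (ℕ)
open import Data.Bool using (Bool; true; false; _∧_; _∨_; not)
open import Data.Product using (Σ; _×_; _,_)
open import Data.Sum using (_⊎_)
open import Data.Empty using (⊥)
open import Data.List using (List)
open import Data.List.Membership.Propositional using (_∈_)
open import Relation.Binary.PropositionalEquality using (_≡_)
open import Relation.Binary.Construct.Closure.ReflexiveTransitive using (Star)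
open import Relation.Binary.Construct.Closure.Symmetric using (SymClosure)

infixr 4 _⇒_
infixr 5 _∨f_
infixr 6 _∧f_

data Formula : Set where
  var  : ℕ → Formula
  ⊥f   : Formula
  ¬f_  : Formula → Formula
  _∧f_ : Formula → Formula → Formula
  _∨f_ : Formula → Formula → Formula
  _⇒_  : Formula → Formula → Formula
  ◇_   : Formula → Formula
  ⟨≠⟩_ : Formula → Formula

□_ : Formula → Formula
□ φ = ¬f (◇ (¬f φ))

[≠]_ : Formula → Formula
[≠] φ = ¬f (⟨≠⟩ (¬f φ))

E_ : Formula → Formula
E φ = (⟨≠⟩ φ) ∨f φ

data ImmSub : Formula → Formula → Set where
  s¬  : ∀ {φ} → ImmSub φ (¬f φ)
  s∧l : ∀ {φ ψ} → ImmSub φ (φ ∧f ψ)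
  s∧r : ∀ {φ ψ} → ImmSub ψ (φ ∧f ψ)
  s∨l : ∀ {φ ψ} → ImmSub φ (φ ∨f ψ)
  s∨r : ∀ {φ ψ} → ImmSub ψ (φ ∨f ψ)
  s⇒l : ∀ {φ ψ} → ImmSub φ (φ ⇒ ψ)
  s⇒r : ∀ {φ ψ} → ImmSub ψ (φ ⇒ ψ)
  s◇  : ∀ {φ} → ImmSub φ (◇ φ)
  s≠  : ∀ {φ} → ImmSub φ (⟨≠⟩ φ)

SubformulaClosed : List Formula → Set
SubformulaClosed Γ = ∀ {φ ψ} → φ ∈ Γ → ImmSub ψ φ → ψ ∈ Γ

_⊆_ : List Formula → List Formula → Set
Γ ⊆ Ψ = ∀ {φ} → φ ∈ Γ → φ ∈ Ψ

sub : (ℕ → Formula) → Formula → Formula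
sub σ (var n)   = σ n
sub σ ⊥f        = ⊥f
sub σ (¬f φ)    = ¬f (sub σ φ)
sub σ (φ ∧f ψ)  = sub σ φ ∧f sub σ ψ
sub σ (φ ∨f ψ)  = sub σ φ ∨f sub σ ψ
sub σ (φ ⇒ ψ)   = sub σ φ ⇒ sub σ ψ
sub σ (◇ φ)     = ◇ (sub σ φ)
sub σ (⟨≠⟩ φ)   = ⟨≠⟩ (sub σ φ)

evalB : (Formula → Bool) → Formula → Bool
evalB v (var n)   = v (var n)
evalB v ⊥f        = false
evalB v (¬f φ)    = not (evalB v φ)
evalB v (φ ∧f ψ)  = evalB v φ ∧ evalB v ψ
evalB v (φ ∨f ψ)  = evalB v φ ∨ evalB v ψ
evalB v (φ ⇒ ψ)   = not (evalB v φ) ∨ evalB v ψ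
evalB v (◇ φ)     = v (◇ φ)
evalB v (⟨≠⟩ φ)   = v (⟨≠⟩ φ)

Tautology : Formula → Set
Tautology φ = ∀ (v : Formula → Bool) → evalB v φ ≡ true

p q : Formula
p = var 0
q = var 1

data KB≠ : Formula → Set where
  taut   : ∀ {φ} → Tautology φ → KB≠ φ
  K◇     : KB≠ (□ (p ⇒ q) ⇒ (□ p ⇒ □ q))
  K≠     : KB≠ ([≠] (p ⇒ q) ⇒ ([≠] p ⇒ [≠] q))
  axB    : KB≠ (p ⇒ □ (◇ p))
  axB≠   : KB≠ (p ⇒ [≠] (⟨≠⟩ p))
  ax≠≠   : KB≠ (⟨≠⟩ (⟨≠⟩ p) ⇒ E p)
  ax◇E   : KB≠ (◇ p ⇒ E p)
  mp     : ∀ {φ ψ} → KB≠ φ → KB≠ (φ ⇒ ψ) → KB≠ ψ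
  nec□   : ∀ {φ} → KB≠ φ → KB≠ (□ φ)
  nec≠   : ∀ {φ} → KB≠ φ → KB≠ ([≠] φ)
  subst  : ∀ {φ} (σ : ℕ → Formula) → KB≠ φ → KB≠ (sub σ φ)

Con : Formula
Con = (E p ∧f E (¬f p)) ⇒ E (p ∧f ◇ (¬f p))

-- Frames, models, Kripke semantics (in Set; used under excluded middle)

record Frame : Set₁ where
  field
    X : Set
    R : X → X → Set
    D : X → X → Set

record Model : Set₁ where
  field
    frame : Frame
  open Frame frame public
  field
    θ : ℕ → X → Set

_⊨[_]_ : (M : Model) → Model.X M → Formula → Set
M ⊨[ x ] var n    = Model.θ M n x
M ⊨[ x ] ⊥f       = ⊥
M ⊨[ x ] (¬f φ)   = M ⊨[ x ] φ → ⊥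
M ⊨[ x ] (φ ∧f ψ) = M ⊨[ x ] φ × M ⊨[ x ] ψ
M ⊨[ x ] (φ ∨f ψ) = M ⊨[ x ] φ ⊎ M ⊨[ x ] ψ
M ⊨[ x ] (φ ⇒ ψ)  = M ⊨[ x ] φ → M ⊨[ x ] ψ
M ⊨[ x ] (◇ φ)    = Σ (Model.X M) λ y → Model.R M x y × M ⊨[ y ] φ
M ⊨[ x ] (⟨≠⟩ φ)  = Σ (Model.X M) λ y → Model.D M x y × M ⊨[ y ] φ

modelOn : (F : Frame) → (ℕ → Frame.X F → Set) → Model
modelOn F v = record { frame = F ; θ = v }

FrameValid : Frame → Formula → Set₁
FrameValid F φ = ∀ (v : ℕ → Frame.X F → Set) (x : Frame.X F) → modelOn F v ⊨[ x ] φ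

ValidatesKB≠ : Frame → Set₁
ValidatesKB≠ F = ∀ {φ} → KB≠ φ → FrameValid F φ

data Reach (F : Frame) (r : Frame.X F) : Frame.X F → Set where
  here  : Reach F r r
  stepR : ∀ {x y} → Reach F r x → Frame.R F x y → Reach F r y
  stepD : ∀ {x y} → Reach F r x → Frame.D F x y → Reach F r y

PointGenerated : Frame → Set
PointGenerated F = Σ (Frame.X F) λ r → ∀ x → Reach F r x

-- Since quotient types are unavailable, the quotient
-- X/∼_Ψ is represented by X itself together with ∼_Ψ; relations and the
-- valuation on the quotient are represented as ∼_Ψ-invariant relations /
-- predicates on representatives.

_↔_ : Set → Set → Set
A ↔ B = (A → B) × (B → A)

Equiv : (M : Model) → List Formula → Model.X M → Model.X M → Set
Equiv M Ψ x y = ∀ {ψ} → ψ ∈ Ψ → (M ⊨[ x ] ψ) ↔ (M ⊨[ y ] ψ)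

record Filtration (M : Model) (Γ Ψ : List Formula) : Set₁ where
  open Model M
  _∼_ : X → X → Set
  _∼_ = Equiv M Ψ
  field
    R̂ : X → X → Set
    D̂ : X → X → Set
    θ̂ : ℕ → X → Set
    R̂-resp : ∀ {x x' y y'} → x ∼ x' → y ∼ y' → R̂ x y → R̂ x' y'
    D̂-resp : ∀ {x x' y y'} → x ∼ x' → y ∼ y' → D̂ x y → D̂ x' y'
    θ̂-resp : ∀ {n x x'} → x ∼ x' → θ̂ n x → θ̂ n x'
    θ̂-var  : ∀ {n x} → var n ∈ Γ → θ̂ n x ↔ θ n x
    R-min  : ∀ {x x' y y'} → x ∼ x' → y ∼ y' → R x' y' → R̂ x y
    R-max  : ∀ {x y} → R̂ x y →
               ∀ {ψ} → (◇ ψ) ∈ Γ → M ⊨[ y ] ψ → M ⊨[ x ] (◇ ψ)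
    D-min  : ∀ {x x' y y'} → x ∼ x' → y ∼ y' → D x' y' → D̂ x y
    D-max  : ∀ {x y} → D̂ x y →
               ∀ {ψ} → (⟨≠⟩ ψ) ∈ Γ → M ⊨[ y ] ψ → M ⊨[ x ] (⟨≠⟩ ψ)

-- (X/∼, S) is connected, for S given on representatives: any two classes
-- [x], [y] are joined by a finite zig-zag S-path of classes.
ConnectedQuot : {X : Set} → (X → X → Set) → (X → X → Set) → Set
ConnectedQuot {X} _∼_ S =
  ∀ x y → Σ X λ y' → Star (SymClosure S) x y' × (y' ∼ y)

-- Validity of KB^≠ makes D ∪ ≡ the universal relation on a point-generated frame, so
-- ∃ behaves as the universal modality.  If the R̂-component C of [x] missed [y], then C,
-- being a union of ∼_Ψ-classes, would be defined by a formula χ (a disjunction of the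
-- finitely many Ψ-types it meets).  The Con instance for χ at x yields a point w ⊨ χ with
-- an R-successor z ⊨ ¬χ; but R w z gives [w] R̂ [z], so z lies in C after all.
module Submission where

open import Defs
open import Data.Nat using (ℕ)
open import Data.List using (List; []; _∷_; _++_; map; foldr; filter)
open import Data.List.Relation.Unary.Any using (here; there)
open import Data.List.Membership.Propositional using (_∈_)
open import Data.List.Membership.Propositional.Properties
  using (∈-map⁺; ∈-map⁻; ∈-++⁺ˡ; ∈-++⁺ʳ; ∈-++⁻; ∈-filter⁺; ∈-filter⁻)
open import Data.Product using (Σ; _×_; _,_; proj₁; proj₂)
open import Data.Sum using (_⊎_; inj₁; inj₂)
open import Data.Empty using (⊥-elim)
open import Relation.Nullary using (¬_; yes; no)
open import Relation.Binary.PropositionalEquality using (_≡_; refl)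
open import Relation.Binary.Construct.Closure.ReflexiveTransitive using (Star; ε; _◅_; _◅◅_)
open import Relation.Binary.Construct.Closure.Symmetric using (SymClosure; fwd)
open import Axiom.ExcludedMiddle using (ExcludedMiddle)
open import Level using (0ℓ)

Equiv-refl : ∀ M Ψ {x} → Equiv M Ψ x x
Equiv-refl M Ψ _ = (λ h → h) , (λ h → h)

Equiv-trans : ∀ M Ψ {x y z} → Equiv M Ψ x y → Equiv M Ψ y z → Equiv M Ψ x z
Equiv-trans M Ψ e f m = (λ h → proj₁ (f m) (proj₁ (e m) h)) , (λ h → proj₂ (e m) (proj₂ (f m) h))

Saturated : (M : Model) → List Formula → (Model.X M → Set) → Set
Saturated M Ψ P = ∀ {z w} → Equiv M Ψ z w → P z → P w

⊤f : Formula
⊤f = ¬f ⊥f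

⋁ : List Formula → Formula
⋁ = foldr _∨f_ ⊥f

-- One conjunction ±ψ₁ ∧ (±ψ₂ ∧ … ⊤) for each choice of signs: the Ψ-types.
literalConjunctions : List Formula → List Formula
literalConjunctions []      = ⊤f ∷ []
literalConjunctions (ψ ∷ Ψ) =
  map (ψ ∧f_) (literalConjunctions Ψ) ++ map ((¬f ψ) ∧f_) (literalConjunctions Ψ)

module _ (M : Model) where
  open Model M using (X)

  ⋁-intro : ∀ {L c z} → c ∈ L → M ⊨[ z ] c → M ⊨[ z ] ⋁ L
  ⋁-intro (here refl) h = inj₁ h
  ⋁-intro (there m)   h = inj₂ (⋁-intro m h)

  ⋁-elim : ∀ L {z} → M ⊨[ z ] ⋁ L → Σ Formula λ c → c ∈ L × M ⊨[ z ] c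
  ⋁-elim (c ∷ L) (inj₁ h) = c , here refl , h
  ⋁-elim (c ∷ L) (inj₂ h) with ⋁-elim L h
  ... | c' , m , h' = c' , there m , h'

  literalConjunction-Equiv : ∀ Ψ {c z w} → c ∈ literalConjunctions Ψ →
    M ⊨[ z ] c → M ⊨[ w ] c → Equiv M Ψ z w
  literalConjunction-Equiv []      _ _ _ ()
  literalConjunction-Equiv (ψ ∷ Ψ) {z = z} {w} m hz hw
    with ∈-++⁻ (map (ψ ∧f_) (literalConjunctions Ψ)) m
  ... | inj₁ m⁺ with ∈-map⁻ (ψ ∧f_) m⁺
  ...   | _ , m' , refl = equiv
    where
    equiv : Equiv M (ψ ∷ Ψ) z w
    equiv (here refl) = (λ _ → proj₁ hw) , (λ _ → proj₁ hz)
    equiv (there k)   = literalConjunction-Equiv Ψ m' (proj₂ hz) (proj₂ hw) k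
  literalConjunction-Equiv (ψ ∷ Ψ) {z = z} {w} m hz hw
      | inj₂ m⁻ with ∈-map⁻ ((¬f ψ) ∧f_) m⁻
  ...   | _ , m' , refl = equiv
    where
    equiv : Equiv M (ψ ∷ Ψ) z w
    equiv (here refl) = (λ h → ⊥-elim (proj₁ hz h)) , (λ h → ⊥-elim (proj₁ hw h))
    equiv (there k)   = literalConjunction-Equiv Ψ m' (proj₂ hz) (proj₂ hw) k

  literalConjunction-exists : ExcludedMiddle 0ℓ → ∀ Ψ z →
    Σ Formula λ c → c ∈ literalConjunctions Ψ × M ⊨[ z ] c
  literalConjunction-exists em []      z = ⊤f , here refl , (λ ())
  literalConjunction-exists em (ψ ∷ Ψ) z with literalConjunction-exists em Ψ z | em {M ⊨[ z ] ψ}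
  ... | c , m , hc | yes hψ = ψ ∧f c , ∈-++⁺ˡ (∈-map⁺ (ψ ∧f_) m) , hψ , hc
  ... | c , m , hc | no ¬hψ =
    (¬f ψ) ∧f c , ∈-++⁺ʳ (map (ψ ∧f_) (literalConjunctions Ψ)) (∈-map⁺ ((¬f ψ) ∧f_) m) , ¬hψ , hc

  saturated-definable : ExcludedMiddle 0ℓ → ∀ Ψ (P : X → Set) → Saturated M Ψ P →
    Σ Formula λ χ → ∀ z → (M ⊨[ z ] χ) ↔ P z
  saturated-definable em Ψ P saturated = ⋁ typesOfP , λ z → elim z , intro z
    where
    MeetsP : Formula → Set
    MeetsP c = Σ X λ w → P w × M ⊨[ w ] c

    typesOfP : List Formula
    typesOfP = filter (λ c → em {MeetsP c}) (literalConjunctions Ψ)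

    elim : ∀ z → M ⊨[ z ] ⋁ typesOfP → P z
    elim z h with ⋁-elim typesOfP h
    ... | c , m , hz with ∈-filter⁻ (λ c → em {MeetsP c}) m
    ...   | m' , w , pw , hw = saturated (literalConjunction-Equiv Ψ m' hw hz) pw

    intro : ∀ z → P z → M ⊨[ z ] ⋁ typesOfP
    intro z pz with literalConjunction-exists em Ψ z
    ... | c , m , hz = ⋁-intro (∈-filter⁺ (λ c → em {MeetsP c}) m (z , pz , hz)) hz

D⁼ : (F : Frame) → Frame.X F → Frame.X F → Set
D⁼ F a b = a ≡ b ⊎ Frame.D F a b

module _ (F : Frame) where
  open Frame F

  pointValuation : X → ℕ → X → Set
  pointValuation a _ y = y ≡ a

  E-pointValuation : ∀ {a c} → modelOn F (pointValuation c) ⊨[ a ] (E p) → D⁼ F a c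
  E-pointValuation (inj₁ (_ , dac , refl)) = inj₂ dac
  E-pointValuation (inj₂ refl)             = inj₁ refl

  D-sym : ExcludedMiddle 0ℓ → FrameValid F (p ⇒ [≠] (⟨≠⟩ p)) → ∀ {a b} → D a b → D b a
  D-sym em valid {a} {b} dab with em {D b a}
  ... | yes dba = dba
  ... | no ¬dba = ⊥-elim (valid (pointValuation a) a refl (b , dab , λ { (_ , dba , refl) → ¬dba dba }))

  DD⊆D⁼ : FrameValid F (⟨≠⟩ (⟨≠⟩ p) ⇒ E p) → ∀ {a b c} → D a b → D b c → D⁼ F a c
  DD⊆D⁼ valid {a} {b} {c} dab dbc = E-pointValuation (valid (pointValuation c) a (b , dab , c , dbc , refl))

  R⊆D⁼ : FrameValid F (◇ p ⇒ E p) → ∀ {a b} → R a b → D⁼ F a b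
  R⊆D⁼ valid {a} {b} rab = E-pointValuation (valid (pointValuation b) a (b , rab , refl))

  module _ (em : ExcludedMiddle 0ℓ) (V : ValidatesKB≠ F) where
    D⁼-sym : ∀ {a b} → D⁼ F a b → D⁼ F b a
    D⁼-sym (inj₁ refl) = inj₁ refl
    D⁼-sym (inj₂ dab)  = inj₂ (D-sym em (V axB≠) dab)

    D⁼-trans : ∀ {a b c} → D⁼ F a b → D⁼ F b c → D⁼ F a c
    D⁼-trans (inj₁ refl) bc          = bc
    D⁼-trans (inj₂ dab)  (inj₁ refl) = inj₂ dab
    D⁼-trans (inj₂ dab)  (inj₂ dbc)  = DD⊆D⁼ (V ax≠≠) dab dbc

    Reach⊆D⁼ : ∀ {r x} → Reach F r x → D⁼ F r x
    Reach⊆D⁼ here         = inj₁ refl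
    Reach⊆D⁼ (stepR h rr) = D⁼-trans (Reach⊆D⁼ h) (R⊆D⁼ (V ax◇E) rr)
    Reach⊆D⁼ (stepD h d)  = D⁼-trans (Reach⊆D⁼ h) (inj₂ d)

    D⁼-universal : PointGenerated F → ∀ a b → D⁼ F a b
    D⁼-universal (_ , reach) a b = D⁼-trans (D⁼-sym (Reach⊆D⁼ (reach a))) (Reach⊆D⁼ (reach b))

module _ (M : Model) where
  open Model M

  E-intro : ∀ {x y φ} → D⁼ frame x y → M ⊨[ y ] φ → M ⊨[ x ] (E φ)
  E-intro (inj₁ refl) h = inj₂ h
  E-intro {y = y} (inj₂ dxy) h = inj₁ (y , dxy , h)

  E-elim : ∀ {x φ} → M ⊨[ x ] (E φ) → Σ X λ w → M ⊨[ w ] φ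
  E-elim     (inj₁ (w , _ , h)) = w , h
  E-elim {x} (inj₂ h)           = x , h

  Con-spreads-R-closed : ∀ χ → (∀ {w z} → R w z → M ⊨[ w ] χ → M ⊨[ z ] χ) →
    ∀ {x y} → M ⊨[ x ] sub (λ _ → χ) Con → D⁼ frame x y → M ⊨[ x ] χ → ¬ ¬ M ⊨[ y ] χ
  Con-spreads-R-closed χ R-closed con xy hx ¬hy
    with E-elim {φ = χ ∧f ◇ (¬f χ)} (con (inj₂ hx , E-intro {φ = ¬f χ} xy ¬hy))
  ... | w , hw , z , rwz , ¬hz = ¬hz (R-closed rwz hw)

module _ (M : Model) (Γ Ψ : List Formula) (Mh : Filtration M Γ Ψ) where
  open Model M
  open Filtration Mh using (R̂; R-min)

  Component : X → X → Set
  Component x z = Σ X λ y → Star (SymClosure R̂) x y × Equiv M Ψ y z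

  Component-saturated : ∀ x → Saturated M Ψ (Component x)
  Component-saturated x z∼w (y , path , y∼z) = y , path , Equiv-trans M Ψ y∼z z∼w

  Component-R-closed : ∀ {x w z} → Component x w → R w z → Component x z
  Component-R-closed {z = z} (y , path , y∼w) rwz =
    z , path ◅◅ fwd (R-min y∼w (Equiv-refl M Ψ) rwz) ◅ ε , Equiv-refl M Ψ

-- Only the minimality condition (R)_∼ ⊆ R̂ of the filtration is needed.
lemma2 : ExcludedMiddle 0ℓ →
    (F : Frame) → PointGenerated F → ValidatesKB≠ F →
    (θ : ℕ → Frame.X F → Set) →
    (∀ (σ : ℕ → Formula) (x : Frame.X F) → modelOn F θ ⊨[ x ] sub σ Con) →
    (Γ : List Formula) → SubformulaClosed Γ →
    (Ψ : List Formula) → Γ ⊆ Ψ →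
    (Mh : Filtration (modelOn F θ) Γ Ψ) →
    ConnectedQuot (Equiv (modelOn F θ) Ψ) (Filtration.R̂ Mh)
lemma2 em F PG V θ con Γ _ Ψ _ Mh x y with em {Component (modelOn F θ) Γ Ψ Mh x y}
... | yes inComponent = inComponent
... | no ¬inComponent =
  ⊥-elim (Con-spreads-R-closed M χ R-closed (con (λ _ → χ) x) (D⁼-universal F em V PG x y)
            (proj₂ (χ-defines x) (x , ε , Equiv-refl M Ψ))
            (λ hy → ¬inComponent (proj₁ (χ-defines y) hy)))
  where
  M : Model
  M = modelOn F θ

  definable : Σ Formula λ χ → ∀ z → (M ⊨[ z ] χ) ↔ Component M Γ Ψ Mh x z
  definable = saturated-definable M em Ψ (Component M Γ Ψ Mh x) (Component-saturated M Γ Ψ Mh x)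

  χ : Formula
  χ = proj₁ definable

  χ-defines : ∀ z → (M ⊨[ z ] χ) ↔ Component M Γ Ψ Mh x z
  χ-defines = proj₂ definable

  R-closed : ∀ {w z} → Frame.R F w z → M ⊨[ w ] χ → M ⊨[ z ] χ
  R-closed {w} {z} rwz hw =
    proj₂ (χ-defines z) (Component-R-closed M Γ Ψ Mh (proj₁ (χ-defines w) hw) rwz)
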